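{- For $m\ge 3$ and $n\ge 3$, writing $n=3k$, $3k+1$ or $3k+2$ with $k$ a positive integer, $$\gamma(P_n\times K_m)= \begin{cases} 2k+1, & n=3k;\\ 2k+2, & n=3k+1 \text{ or } n=3k+2.\end{cases}$$
   Context: $P_n$ is the path on $\{1,\dots,n\}$ with edges $\{i,i+1\}$, $1\le i\le n-1$; $K_m$ is the complete graph on $\{1,\dots,m\}$. The direct product $G\times H$ has vertex set $V(G)\times V(H)$ with $(g_1,h_1)\sim(g_2,h_2)$ iff $g_1g_2\in E(G)$ and $h_1h_2\in E(H)$. $\gamma(G)$ denotes the domination number: the minimum size of a set $D$ of vertices such that every vertex not in $D$ is adjacent to a vertex of $D$. -}

module Defs where

open import Data.Nat using (ℕ; suc; _+_; _≤_)
open import Data.Fin using (Fin; toℕ)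
open import Data.Product using (_×_; _,_; Σ; ∃)
open import Data.Sum using (_⊎_)
open import Data.List using (List; length)
open import Data.List.Membership.Propositional using (_∈_)
open import Data.List.Relation.Unary.Unique.Propositional using (Unique)
open import Relation.Binary.PropositionalEquality using (_≡_; _≢_)
open import Relation.Nullary using (¬_)
open import Level using (0ℓ)

record Graph : Set₁ where
  field
    V   : Set
    Adj : V → V → Set
open Graph public

-- Path P_n on vertices {1..n}, represented as Fin n (0-based): i ~ j iff |i - j| = 1.
P : ℕ → Graph
P n = record { V = Fin n ; Adj = λ i j → (suc (toℕ i) ≡ toℕ j) ⊎ (suc (toℕ j) ≡ toℕ i) }

K : ℕ → Graph
K m = record { V = Fin m ; Adj = λ i j → i ≢ j }

_×ᴳ_ : Graph → Graph → Graph
G ×ᴳ H = record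
  { V = V G × V H
  ; Adj = λ { (g₁ , h₁) (g₂ , h₂) → Adj G g₁ g₂ × Adj H h₁ h₂ } }

record VSet (G : Graph) : Set where
  field
    elems  : List (V G)
    unique : Unique elems
open VSet public

size : ∀ {G} → VSet G → ℕ
size D = length (elems D)

Dominating : (G : Graph) → VSet G → Set
Dominating G D = ∀ v → (v ∈ elems D) ⊎ ∃ λ u → (u ∈ elems D) × Adj G v u

DominationNumber : Graph → ℕ → Set
DominationNumber G d =
  (∃ λ (D : VSet G) → Dominating G D × size D ≡ d)
  × (∀ (D : VSet G) → Dominating G D → d ≤ size D)

-- Lower bound: a vertex (j , x) of P n ×ᴳ K m is dominated from columns j - 1, j, j + 1. Choosing a
-- second vertex of column j whose colour is that of the first dominator (or, if (j , x) dominates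
-- itself, any other colour) forces a second, distinct dominator in the same three columns, so every
-- window of three consecutive columns contains two vertices of a dominating set; disjoint windows
-- give 2k + 2 vertices as soon as n ≥ 3k + 1. For n = 3k one more vertex comes from the first four
-- columns: a column whose neighbouring columns contain no vertex of the set must lie entirely in
-- it, and has m ≥ 3 vertices.
--
-- Upper bound: the row {(j , 0)} dominates when n ≥ 2, which handles n = 2, 3, 4. Given a dominating
-- set with a vertex (0 , a) in the first column, shifting it by three columns and adding (0 , c) and
-- (1 , c) with c ≠ a dominates three more columns at the cost of two vertices: the shifted (3 , a)
-- takes care of (2 , c).
module Submission where

open import Defs
open import Data.Empty using (⊥-elim)
open import Data.Fin using (Fin; toℕ; fromℕ<; punchIn; inject₁) renaming (zero to fzero; suc to fsuc)
open import Data.Fin.Properties using (toℕ-fromℕ<; toℕ-inject₁; punchInᵢ≢i) renaming (_≟_ to _≟ᶠ_)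
open import Data.List using (List; []; _∷_; _++_; length; filter; map; tabulate)
open import Data.List.Membership.Propositional using (_∈_)
open import Data.List.Membership.Propositional.Properties
  using (∈-∃++; ∈-++⁻; ∈-++⁺ˡ; ∈-++⁺ʳ; ∈-filter⁺; ∈-map⁺; ∈-tabulate⁺; ∈-tabulate⁻)
open import Data.List.Properties
  using (length-++; length-map; length-filter; length-tabulate; filter-none; filter-≐)
open import Data.List.Relation.Binary.Subset.Propositional using (_⊆_)
open import Data.List.Relation.Unary.All as All using ([]; _∷_)
open import Data.List.Relation.Unary.All.Properties using () renaming (map⁺ to All-map⁺)
open import Data.List.Relation.Unary.AllPairs using ([]; _∷_)
open import Data.List.Relation.Unary.Any using (here; there)
open import Data.List.Relation.Unary.Unique.Propositional using (Unique)
open import Data.List.Relation.Unary.Unique.Propositional.Properties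
  using (tabulate⁺) renaming (map⁺ to Unique-map⁺)
open import Data.Nat using (ℕ; zero; suc; _+_; _*_; _∸_; _≤_; _<_; z≤n; s≤s; s≤s⁻¹; _≤?_; _<?_)
open import Data.Nat.Properties
open import Data.Nat.Tactic.RingSolver using (solve-∀)
open import Data.Product using (_×_; _,_; proj₁; proj₂; ∃; map₁)
open import Data.Sum as Sum using (_⊎_; inj₁; inj₂)
open import Function using (_∘_)
open import Level using (0ℓ)
open import Relation.Binary.PropositionalEquality
open import Relation.Nullary using (¬_; yes; no; _×-dec_)
open import Relation.Unary using (Pred; Decidable; _∪_; _≐_)
open import Relation.Unary.Properties using (_∪?_)

module _ {A : Set} where

  Unique-⊆⇒length≤ : {ys xs : List A} → Unique ys → ys ⊆ xs → length ys ≤ length xs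
  Unique-⊆⇒length≤ {[]} _ _ = z≤n
  Unique-⊆⇒length≤ {y ∷ ys} (y∉ys ∷ unique) y∷ys⊆xs with ∈-∃++ (y∷ys⊆xs (here refl))
  ... | as , bs , refl = begin
    suc (length ys)             ≤⟨ s≤s (Unique-⊆⇒length≤ unique ys⊆as++bs) ⟩
    suc (length (as ++ bs))     ≡⟨ cong suc (length-++ as) ⟩
    suc (length as + length bs) ≡⟨ +-suc (length as) (length bs) ⟨
    length as + length (y ∷ bs) ≡⟨ length-++ as ⟨
    length (as ++ y ∷ bs)       ∎
    where
    open ≤-Reasoning
    ys⊆as++bs : ys ⊆ as ++ bs
    ys⊆as++bs {z} z∈ys with ∈-++⁻ as (y∷ys⊆xs (there z∈ys))
    ... | inj₁ z∈as = ∈-++⁺ˡ z∈as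
    ... | inj₂ (here refl) = ⊥-elim (All.lookup y∉ys z∈ys refl)
    ... | inj₂ (there z∈bs) = ∈-++⁺ʳ as z∈bs

  length-filter-∪ : ∀ {ℓ} {P Q : Pred A ℓ} (P? : Decidable P) (Q? : Decidable Q) →
                    (∀ x → P x → ¬ Q x) → ∀ xs →
                    length (filter (P? ∪? Q?) xs) ≡ length (filter P? xs) + length (filter Q? xs)
  length-filter-∪ P? Q? disjoint [] = refl
  length-filter-∪ P? Q? disjoint (x ∷ xs) with P? x | Q? x
  ... | yes p | yes q = ⊥-elim (disjoint x p q)
  ... | yes _ | no _ = cong suc (length-filter-∪ P? Q? disjoint xs)
  ... | no _ | yes _ = trans (cong suc (length-filter-∪ P? Q? disjoint xs)) (sym (+-suc _ _))
  ... | no _ | no _ = length-filter-∪ P? Q? disjoint xs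

∀Fin⇒∀< : ∀ {n} (Q : ℕ → Set) → (∀ (j : Fin n) → Q (toℕ j)) → ∀ {j} → j < n → Q j
∀Fin⇒∀< Q holds j<n = subst Q (toℕ-fromℕ< j<n) (holds (fromℕ< j<n))

another : ∀ {m} → 2 ≤ m → Fin m → Fin m
another {suc _} (s≤s 1≤m) x = punchIn x (fromℕ< 1≤m)

another≢ : ∀ {m} (2≤m : 2 ≤ m) (x : Fin m) → another 2≤m x ≢ x
another≢ {suc _} (s≤s 1≤m) x = punchInᵢ≢i x (fromℕ< 1≤m)

Near : (G : Graph) → V G → V G → Set
Near G v w = w ≡ v ⊎ Adj G v w

dominator : ∀ {G D} → Dominating G D → ∀ v → ∃ λ w → w ∈ elems D × Near G v w
dominator dominating v with dominating v
... | inj₁ v∈D = v , v∈D , inj₁ refl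
... | inj₂ (u , u∈D , adj) = u , u∈D , inj₂ adj

path-irreflexive : ∀ {n} (j : Fin n) → ¬ Adj (P n) j j
path-irreflexive j (inj₁ eq) = 1+n≢n eq
path-irreflexive j (inj₂ eq) = 1+n≢n eq

module _ {n m : ℕ} where

  near-same-column : ∀ {j : Fin n} {x y : Fin m} → Near (P n ×ᴳ K m) (j , x) (j , y) → y ≡ x
  near-same-column (inj₁ refl) = refl
  near-same-column (inj₂ (adj , _)) = ⊥-elim (path-irreflexive _ adj)

  near-same-colour : ∀ {i j : Fin n} {x : Fin m} → Near (P n ×ᴳ K m) (j , x) (i , x) → i ≡ j
  near-same-colour (inj₁ refl) = refl
  near-same-colour (inj₂ (_ , x≢x)) = ⊥-elim (x≢x refl)

module ColumnCount {n m : ℕ} (D : VSet (P n ×ᴳ K m)) where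

  column : Fin n × Fin m → ℕ
  column = toℕ ∘ proj₁

  InColumns : ℕ → ℕ → Pred (Fin n × Fin m) 0ℓ
  InColumns a b v = a ≤ column v × column v < b

  inColumns? : ∀ a b → Decidable (InColumns a b)
  inColumns? a b v = a ≤? column v ×-dec column v <? b

  #[_,_⟩ : ℕ → ℕ → ℕ
  #[ a , b ⟩ = length (filter (inColumns? a b) (elems D))

  #-split : ∀ {a b c} → a ≤ b → b ≤ c → #[ a , c ⟩ ≡ #[ a , b ⟩ + #[ b , c ⟩
  #-split {a} {b} {c} a≤b b≤c = begin
    #[ a , c ⟩
      ≡⟨ cong length (filter-≐ (inColumns? a c) _ split (elems D)) ⟩
    length (filter (inColumns? a b ∪? inColumns? b c) (elems D))
      ≡⟨ length-filter-∪ (inColumns? a b) (inColumns? b c) disjoint (elems D) ⟩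
    #[ a , b ⟩ + #[ b , c ⟩
      ∎
    where
    open ≡-Reasoning
    to : ∀ v → InColumns a c v → (InColumns a b ∪ InColumns b c) v
    to v (a≤v , v<c) with column v <? b
    ... | yes v<b = inj₁ (a≤v , v<b)
    ... | no v≮b = inj₂ (≮⇒≥ v≮b , v<c)
    from : ∀ v → (InColumns a b ∪ InColumns b c) v → InColumns a c v
    from _ (inj₁ (a≤v , v<b)) = a≤v , <-≤-trans v<b b≤c
    from _ (inj₂ (b≤v , v<c)) = ≤-trans a≤b b≤v , v<c
    split : InColumns a c ≐ (InColumns a b ∪ InColumns b c)
    split = (λ {v} → to v) , (λ {v} → from v)
    disjoint : ∀ v → InColumns a b v → ¬ InColumns b c v
    disjoint _ (_ , v<b) (b≤v , _) = <⇒≱ v<b b≤v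

  #≤size : ∀ a b → #[ a , b ⟩ ≤ size D
  #≤size a b = length-filter (inColumns? a b) (elems D)

  #-empty : ∀ a → #[ a , a ⟩ ≡ 0
  #-empty a =
    cong length (filter-none (inColumns? a a) (All.universal (λ _ (a≤v , v<a) → <⇒≱ v<a a≤v) (elems D)))

  Unique-⊆⇒≤# : ∀ {a b ys} → Unique ys → (∀ {w} → w ∈ ys → w ∈ elems D × InColumns a b w) →
                length ys ≤ #[ a , b ⟩
  Unique-⊆⇒≤# unique ys⊆ =
    Unique-⊆⇒length≤ unique (λ w∈ys → let w∈D , w∈ab = ys⊆ w∈ys in ∈-filter⁺ (inColumns? _ _) w∈D w∈ab)

  #≡0⇒∉ : ∀ {a b w} → #[ a , b ⟩ ≡ 0 → w ∈ elems D → ¬ InColumns a b w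
  #≡0⇒∉ #≡0 w∈D w∈ab with subst (1 ≤_) #≡0 (Unique-⊆⇒≤# ([] ∷ []) λ { (here refl) → w∈D , w∈ab })
  ... | ()

  2≤# : ∀ {a b w w′} → w ∈ elems D → w′ ∈ elems D → w ≢ w′ → InColumns a b w → InColumns a b w′ →
        2 ≤ #[ a , b ⟩
  2≤# w∈D w′∈D w≢w′ w∈ab w′∈ab =
    Unique-⊆⇒≤# ((w≢w′ ∷ []) ∷ [] ∷ []) λ { (here refl) → w∈D , w∈ab ; (there (here refl)) → w′∈D , w′∈ab }

  near⇒InColumns : ∀ {j x w} → Near (P n ×ᴳ K m) (j , x) w → InColumns (toℕ j ∸ 1) (2 + toℕ j) w
  near⇒InColumns {j} (inj₁ refl) = m∸n≤m (toℕ j) 1 , s≤s (n≤1+n (toℕ j))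
  near⇒InColumns {j} (inj₂ (inj₁ j+1≡i , _)) =
    ≤-trans (m∸n≤m (toℕ j) 1) (≤-trans (n≤1+n (toℕ j)) (≤-reflexive j+1≡i)) , s≤s (≤-reflexive (sym j+1≡i))
  near⇒InColumns {j} (inj₂ (inj₂ i+1≡j , _)) =
    ≤-reflexive (cong (_∸ 1) (sym i+1≡j)) , ≤-trans (≤-reflexive i+1≡j) (m≤n+m (toℕ j) 2)

  module _ (dominating : Dominating (P n ×ᴳ K m) D) where

    dominatorOf : ∀ v → ∃ λ w → w ∈ elems D × Near (P n ×ᴳ K m) v w
    dominatorOf = dominator {P n ×ᴳ K m} {D} dominating

    2≤#-around : 2 ≤ m → (j : Fin n) → 2 ≤ #[ toℕ j ∸ 1 , 2 + toℕ j ⟩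
    2≤#-around 2≤m@(s≤s (s≤s _)) j with dominatorOf (j , fzero)
    ... | w , w∈D , inj₁ refl with dominatorOf (j , another 2≤m fzero)
    ...   | w′ , w′∈D , near′ =
      2≤# w∈D w′∈D (λ { refl → another≢ 2≤m fzero (sym (near-same-column near′)) })
        (near⇒InColumns {x = fzero} (inj₁ refl)) (near⇒InColumns near′)
    2≤#-around _ j | (i , x) , u∈D , inj₂ adj with dominatorOf (j , x)
    ...   | w′ , w′∈D , near′ =
      2≤# u∈D w′∈D (λ { refl → path-irreflexive j (subst (Adj (P n) j) (near-same-colour near′) (proj₁ adj)) })
        (near⇒InColumns (inj₂ adj)) (near⇒InColumns near′)

    2≤#-window : 2 ≤ m → ∀ {j} → j < n → 2 ≤ #[ j ∸ 1 , 2 + j ⟩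
    2≤#-window 2≤m = ∀Fin⇒∀< (λ j → 2 ≤ #[ j ∸ 1 , 2 + j ⟩) (2≤#-around 2≤m)

    isolated-column⊆D : (j : Fin n) → (∀ {w} → w ∈ elems D → ¬ Adj (P n) j (proj₁ w)) →
                        ∀ x → (j , x) ∈ elems D
    isolated-column⊆D j isolated x with dominatorOf (j , x)
    ... | _ , w∈D , inj₁ refl = w∈D
    ... | _ , w∈D , inj₂ (adj , _) = ⊥-elim (isolated w∈D adj)

    m≤#-isolated-column : (j : Fin n) → #[ toℕ j ∸ 1 , toℕ j ⟩ ≡ 0 → #[ suc (toℕ j) , 2 + toℕ j ⟩ ≡ 0 →
                          m ≤ #[ toℕ j , suc (toℕ j) ⟩
    m≤#-isolated-column j left≡0 right≡0 = subst (_≤ #[ toℕ j , suc (toℕ j) ⟩) (length-tabulate (j ,_))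
      (Unique-⊆⇒≤# (tabulate⁺ (cong proj₂)) column⊆D)
      where
      isolated : ∀ {w} → w ∈ elems D → ¬ Adj (P n) j (proj₁ w)
      isolated w∈D (inj₁ j+1≡i) =
        #≡0⇒∉ right≡0 w∈D (≤-reflexive j+1≡i , s≤s (≤-reflexive (sym j+1≡i)))
      isolated w∈D (inj₂ i+1≡j) =
        #≡0⇒∉ left≡0 w∈D (≤-reflexive (cong (_∸ 1) (sym i+1≡j)) , ≤-reflexive i+1≡j)
      column⊆D : ∀ {w} → w ∈ tabulate (j ,_) → w ∈ elems D × InColumns (toℕ j) (suc (toℕ j)) w
      column⊆D w∈column with ∈-tabulate⁻ w∈column
      ... | x , refl = isolated-column⊆D j isolated x , ≤-refl , ≤-refl

    m≤#-isolated : ∀ {j} → j < n → #[ j ∸ 1 , j ⟩ ≡ 0 → #[ suc j , 2 + j ⟩ ≡ 0 → m ≤ #[ j , suc j ⟩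
    m≤#-isolated = ∀Fin⇒∀< (λ j → #[ j ∸ 1 , j ⟩ ≡ 0 → #[ suc j , 2 + j ⟩ ≡ 0 → m ≤ #[ j , suc j ⟩)
                           m≤#-isolated-column

    3≤#-first-four : 3 ≤ m → 3 ≤ n → 3 ≤ #[ 0 , 4 ⟩
    3≤#-first-four 3≤m 3≤n = subst (3 ≤_) (sym four-columns)
      (three-among-four
        (subst (2 ≤_) (#-split z≤n (s≤s z≤n)) (2≤#-window 2≤m (≤-trans (s≤s z≤n) 3≤n)))
        (subst (2 ≤_) last-three (2≤#-window 2≤m 3≤n))
        (λ #₁≡0 → ≤-trans 3≤m (m≤#-isolated (≤-trans (s≤s z≤n) 3≤n) (#-empty 0) #₁≡0))
        (λ #₀≡0 #₂≡0 → ≤-trans 3≤m (m≤#-isolated (≤-trans (s≤s (s≤s z≤n)) 3≤n) #₀≡0 #₂≡0)))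
      where
      open ≡-Reasoning
      2≤m : 2 ≤ m
      2≤m = ≤-trans (n≤1+n 2) 3≤m
      last-three : #[ 1 , 4 ⟩ ≡ #[ 1 , 2 ⟩ + (#[ 2 , 3 ⟩ + #[ 3 , 4 ⟩)
      last-three = begin
        #[ 1 , 4 ⟩
          ≡⟨ #-split (s≤s z≤n) (s≤s (s≤s z≤n)) ⟩
        #[ 1 , 2 ⟩ + #[ 2 , 4 ⟩
          ≡⟨ cong (#[ 1 , 2 ⟩ +_) (#-split (s≤s (s≤s z≤n)) (s≤s (s≤s (s≤s z≤n)))) ⟩
        #[ 1 , 2 ⟩ + (#[ 2 , 3 ⟩ + #[ 3 , 4 ⟩)
          ∎
      four-columns : #[ 0 , 4 ⟩ ≡ #[ 0 , 1 ⟩ + (#[ 1 , 2 ⟩ + (#[ 2 , 3 ⟩ + #[ 3 , 4 ⟩))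
      four-columns = trans (#-split z≤n (s≤s z≤n)) (cong (#[ 0 , 1 ⟩ +_) last-three)
      three-among-four : ∀ {a b c d} → 2 ≤ a + b → 2 ≤ b + (c + d) → (b ≡ 0 → 3 ≤ a) →
                         (a ≡ 0 → c ≡ 0 → 3 ≤ b) → 3 ≤ a + (b + (c + d))
      three-among-four {a} {zero} _ _ isolated₀ _ = ≤-trans (isolated₀ refl) (m≤m+n a _)
      three-among-four {zero} {suc zero} (s≤s ()) _ _ _
      three-among-four {suc a} {suc zero} {c} {d} _ two _ _ = s≤s (≤-trans two (m≤n+m (suc (c + d)) a))
      three-among-four {suc a} {suc (suc b)} _ _ _ _ = s≤s (≤-trans (s≤s (s≤s z≤n)) (m≤n+m _ a))
      three-among-four {zero} {suc (suc b)} {zero} _ _ _ isolated₁ = ≤-trans (isolated₁ refl refl) (m≤m+n _ _)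
      three-among-four {zero} {suc (suc b)} {suc c} _ _ _ _ = s≤s (s≤s (≤-trans (s≤s z≤n) (m≤n+m _ b)))

    2q≤#-windows : 2 ≤ m → ∀ q {t} → t + 3 * q ≤ suc n → 2 * q ≤ #[ t , t + 3 * q ⟩
    2q≤#-windows _ zero _ = z≤n
    2q≤#-windows 2≤m (suc q) {t} bound = begin
      2 * suc q                                   ≡⟨ *-suc 2 q ⟩
      2 + 2 * q                                   ≤⟨ +-mono-≤ (2≤#-window 2≤m (s≤s⁻¹ 3+t≤1+n))
                                                              (2q≤#-windows 2≤m q bound′) ⟩
      #[ t , 3 + t ⟩ + #[ 3 + t , 3 + t + 3 * q ⟩ ≡⟨ #-split (m≤n+m t 3) (m≤m+n (3 + t) (3 * q)) ⟨
      #[ t , 3 + t + 3 * q ⟩                      ≡⟨ cong #[ t ,_⟩ (shift t q) ⟩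
      #[ t , t + 3 * suc q ⟩                      ∎
      where
      open ≤-Reasoning
      shift : ∀ t q → 3 + t + 3 * q ≡ t + 3 * suc q
      shift = solve-∀
      bound′ : 3 + t + 3 * q ≤ suc n
      bound′ = subst (_≤ suc n) (sym (shift t q)) bound
      3+t≤1+n : 3 + t ≤ suc n
      3+t≤1+n = ≤-trans (m≤m+n (3 + t) (3 * q)) bound′

    lower-bound : 2 ≤ m → ∀ {B t} q → B ≤ #[ 0 , t ⟩ → t + 3 * q ≤ suc n → B + 2 * q ≤ size D
    lower-bound 2≤m {B} {t} q B≤# bound = begin
      B + 2 * q                       ≤⟨ +-mono-≤ B≤# (2q≤#-windows 2≤m q bound) ⟩
      #[ 0 , t ⟩ + #[ t , t + 3 * q ⟩ ≡⟨ #-split z≤n (m≤m+n t (3 * q)) ⟨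
      #[ 0 , t + 3 * q ⟩              ≤⟨ #≤size 0 (t + 3 * q) ⟩
      size D                          ∎
      where open ≤-Reasoning

    2k+1≤size : 3 ≤ m → ∀ k → 1 ≤ k → 3 * k ≤ n → 2 * k + 1 ≤ size D
    2k+1≤size _ zero () _
    2k+1≤size 3≤m (suc k) _ 3k≤n = subst (_≤ size D) (3+2k≡2[1+k]+1 k)
      (lower-bound (≤-trans (n≤1+n 2) 3≤m) k (3≤#-first-four 3≤m (≤-trans (m≤m+n 3 (3 * k)) 3+3k≤n))
                   (s≤s 3+3k≤n))
      where
      3+2k≡2[1+k]+1 : ∀ k → 3 + 2 * k ≡ 2 * suc k + 1
      3+2k≡2[1+k]+1 = solve-∀
      3+3k≤n : 3 + 3 * k ≤ n
      3+3k≤n = subst (_≤ n) (*-suc 3 k) 3k≤n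

    2k+2≤size : 2 ≤ m → ∀ k → 3 * k + 1 ≤ n → 2 * k + 2 ≤ size D
    2k+2≤size 2≤m k 3k+1≤n = subst (_≤ size D) (+-comm 2 (2 * k))
      (lower-bound 2≤m k (2≤#-window 2≤m (≤-trans (m≤n+m 1 (3 * k)) 3k+1≤n))
                   (s≤s (subst (_≤ n) (+-comm (3 * k) 1) 3k+1≤n)))

record AnchoredDominatingSet (n m s : ℕ) : Set where
  field
    set          : VSet (P n ×ᴳ K m)
    dominating   : Dominating (P n ×ᴳ K m) set
    size≡        : size set ≡ s
    anchor       : Fin n × Fin m
    anchor∈      : anchor ∈ elems set
    anchor-first : toℕ (proj₁ anchor) ≡ 0

first-row : ∀ {n m} → 2 ≤ n → 1 ≤ m → AnchoredDominatingSet n m n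
first-row {suc (suc n)} {suc m} (s≤s (s≤s _)) (s≤s _) = record
  { set          = first-row-set
  ; dominating   = dominating
  ; size≡        = length-tabulate row₀
  ; anchor       = row₀ fzero
  ; anchor∈      = row₀∈ fzero
  ; anchor-first = refl
  }
  where
  row₀ : Fin (2 + n) → Fin (2 + n) × Fin (suc m)
  row₀ j = j , fzero
  row₀∈ : ∀ j → row₀ j ∈ tabulate row₀
  row₀∈ = ∈-tabulate⁺
  first-row-set : VSet (P (2 + n) ×ᴳ K (suc m))
  first-row-set = record { elems = tabulate row₀ ; unique = tabulate⁺ {f = row₀} (cong proj₁) }
  dominating : Dominating (P (2 + n) ×ᴳ K (suc m)) first-row-set
  dominating (j , fzero) = inj₁ (row₀∈ j)
  dominating (fzero , fsuc x) = inj₂ (row₀ (fsuc fzero) , row₀∈ (fsuc fzero) , inj₁ refl , λ ())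
  dominating (fsuc j , fsuc x) =
    inj₂ (row₀ (inject₁ j) , row₀∈ (inject₁ j) , inj₂ (cong suc (toℕ-inject₁ j)) , λ ())

module _ {n m : ℕ} where

  shift₃ : Fin n × Fin m → Fin (3 + n) × Fin m
  shift₃ (j , x) = fsuc (fsuc (fsuc j)) , x

  shift₃-injective : ∀ {v w} → shift₃ v ≡ shift₃ w → v ≡ w
  shift₃-injective {_ , _} {_ , _} refl = refl

  shift₃-adjacent : ∀ {v w} → Adj (P n ×ᴳ K m) v w → Adj (P (3 + n) ×ᴳ K m) (shift₃ v) (shift₃ w)
  shift₃-adjacent = map₁ (Sum.map (cong (3 +_)) (cong (3 +_)))

extend : ∀ {n m s} → 2 ≤ m → AnchoredDominatingSet n m s → AnchoredDominatingSet (3 + n) m (2 + s)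
extend {n} {m} 2≤m A = record
  { set          = extended-set
  ; dominating   = dominating′
  ; size≡        = cong (2 +_) (trans (length-map shift₃ (elems set)) size≡)
  ; anchor       = fzero , c
  ; anchor∈      = here refl
  ; anchor-first = refl
  }
  where
  open AnchoredDominatingSet A
  c : Fin m
  c = another 2≤m (proj₂ anchor)
  extended-set : VSet (P (3 + n) ×ᴳ K m)
  extended-set = record
    { elems  = (fzero , c) ∷ (fsuc fzero , c) ∷ map shift₃ (elems set)
    ; unique = ((λ ()) ∷ All-map⁺ (All.universal (λ _ ()) (elems set)))
             ∷ All-map⁺ (All.universal (λ _ ()) (elems set))
             ∷ Unique-map⁺ shift₃-injective (unique set)
    }
  shifted∈ : ∀ {v} → v ∈ elems set → shift₃ v ∈ elems extended-set
  shifted∈ v∈D = there (there (∈-map⁺ shift₃ v∈D))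
  dominating′ : Dominating (P (3 + n) ×ᴳ K m) extended-set
  dominating′ (fzero , x) with x ≟ᶠ c
  ... | yes refl = inj₁ (here refl)
  ... | no x≢c = inj₂ ((fsuc fzero , c) , there (here refl) , inj₁ refl , x≢c)
  dominating′ (fsuc fzero , x) with x ≟ᶠ c
  ... | yes refl = inj₁ (there (here refl))
  ... | no x≢c = inj₂ ((fzero , c) , here refl , inj₂ refl , x≢c)
  dominating′ (fsuc (fsuc fzero) , x) with x ≟ᶠ c
  ... | yes refl = inj₂ (shift₃ anchor , shifted∈ anchor∈ , inj₁ (cong (3 +_) (sym anchor-first)) ,
                         another≢ 2≤m (proj₂ anchor))
  ... | no x≢c = inj₂ ((fsuc fzero , c) , there (here refl) , inj₂ refl , x≢c)
  dominating′ (fsuc (fsuc (fsuc j)) , x) with dominating (j , x)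
  ... | inj₁ v∈D = inj₁ (shifted∈ v∈D)
  ... | inj₂ (u , u∈D , adj) = inj₂ (shift₃ u , shifted∈ u∈D , shift₃-adjacent adj)

extend-by : ∀ {n m s} → 2 ≤ m → ∀ q → AnchoredDominatingSet n m s →
            AnchoredDominatingSet (q * 3 + n) m (q * 2 + s)
extend-by _ zero A = A
extend-by 2≤m (suc q) A = extend 2≤m (extend-by 2≤m q A)

dominating-set : ∀ {n m s r} q → 2 ≤ m → 2 ≤ r → n ≡ q * 3 + r → s ≡ q * 2 + r →
                 ∃ λ D → Dominating (P n ×ᴳ K m) D × size D ≡ s
dominating-set q 2≤m 2≤r refl refl = set , dominating , size≡
  where open AnchoredDominatingSet (extend-by 2≤m q (first-row 2≤r (≤-trans (s≤s z≤n) 2≤m)))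

theorem4p5 : ∀ (m n k : ℕ) → 3 ≤ m → 1 ≤ k →
    (n ≡ 3 * k → DominationNumber (P n ×ᴳ K m) (2 * k + 1))
    × ((n ≡ 3 * k + 1) ⊎ (n ≡ 3 * k + 2) → DominationNumber (P n ×ᴳ K m) (2 * k + 2))
theorem4p5 m n zero _ ()
theorem4p5 m n (suc k) 3≤m 1≤k = multiple-of-three , not-multiple-of-three
  where
  open ColumnCount using (2k+1≤size; 2k+2≤size)
  2≤m : 2 ≤ m
  2≤m = ≤-trans (n≤1+n 2) 3≤m
  a[1+k]+r≡ka+[a+r] : ∀ a k r → a * suc k + r ≡ k * a + (a + r)
  a[1+k]+r≡ka+[a+r] = solve-∀
  multiple-of-three : n ≡ 3 * suc k → DominationNumber (P n ×ᴳ K m) (2 * suc k + 1)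
  multiple-of-three refl =
    dominating-set k 2≤m (n≤1+n 2) (trans (*-comm 3 (suc k)) (+-comm 3 (k * 3))) (a[1+k]+r≡ka+[a+r] 2 k 1) ,
    λ D dominating → 2k+1≤size D dominating 3≤m (suc k) 1≤k ≤-refl
  not-multiple-of-three : (n ≡ 3 * suc k + 1) ⊎ (n ≡ 3 * suc k + 2) →
                          DominationNumber (P n ×ᴳ K m) (2 * suc k + 2)
  not-multiple-of-three (inj₁ refl) =
    dominating-set k 2≤m (≤-trans (n≤1+n 2) (n≤1+n 3)) (a[1+k]+r≡ka+[a+r] 3 k 1) (a[1+k]+r≡ka+[a+r] 2 k 2) ,
    λ D dominating → 2k+2≤size D dominating 2≤m (suc k) ≤-refl
  not-multiple-of-three (inj₂ refl) =
    dominating-set (suc k) 2≤m ≤-refl (cong (_+ 2) (*-comm 3 (suc k))) (cong (_+ 2) (*-comm 2 (suc k))) ,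
    λ D dominating → 2k+2≤size D dominating 2≤m (suc k) (+-monoʳ-≤ (3 * suc k) (n≤1+n 1))
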